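{- Let $p$ be a prime, $K\geq 2$ an integer, and $\beta=\frac{1-p^{ -3/2}}{1+p^{ -3/2}}$. Define $\varphi^*(p^k)=\frac{k\beta+1}{p^{3k/4}}$ for integers $k\geq 0$, let $\mathcal{M}_K$ be the $K\times K$ matrix with entries $\mathcal{M}_K(i,j)=\varphi^*(p^{|i-j|})$, and let $\mathcal{U}_K$ be the $K\times K$ matrix with $$\mathcal{U}_K(i,j)=\begin{cases}\dfrac{\mu(p^{|i-j|})}{p^{3|i-j|/4}}, & \text{if } i\geq j \text{ or } (i,j)=(K-1,K),\\ 0, & \text{otherwise}\end{cases}$$ (so $\mathcal{U}_K$ has $1$ on the diagonal, $-p^{ -3/4}$ at the entries $(i+1,i)$ and at $(K-1,K)$, and $0$ elsewhere). Then $\mathcal{A}_K=\mathcal{U}_K^{\top}\mathcal{M}_K\,\mathcal{U}_K$ is given by $$\mathcal{A}_K(i,j)=\beta(1-p^{ -3/2})\cdot\begin{cases}p^{ -3|i-j|/4}, & \text{if } 1\leq i,j\leq K-1 \text{ or } i=j=K,\\ 0, & \text{otherwise}.\end{cases}$$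
   Context: $\mu$ is the Möbius function, so $\mu(1)=1$, $\mu(p)=-1$ and $\mu(p^m)=0$ for $m\geq 2$. -}

module Defs where

open import Level using (Level)
open import Algebra.Bundles using (CommutativeRing)
open import Data.Nat as ℕ using (ℕ; zero; suc; ∣_-_∣; _∸_)
open import Data.Fin using (Fin; toℕ)
import Data.Fin as F
open import Data.Bool using (Bool; true; false; if_then_else_; _∧_; _∨_)
open import Relation.Nullary.Decidable using (⌊_⌋)

-- Matrices over a commutative ring R (standing in for ℝ),
-- indexed by Fin K (0-based: paper index i corresponds to toℕ i + 1).
module Matrices {c ℓ : Level} (R : CommutativeRing c ℓ) where
  open CommutativeRing R

  pow : Carrier → ℕ → Carrier
  pow x zero    = 1#
  pow x (suc n) = x * pow x n

  fromℕ : ℕ → Carrier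
  fromℕ zero    = 0#
  fromℕ (suc n) = 1# + fromℕ n

  sumFin : (K : ℕ) → (Fin K → Carrier) → Carrier
  sumFin zero    f = 0#
  sumFin (suc K) f = f F.zero + sumFin K (λ i → f (F.suc i))

  Matrix : ℕ → Set c
  Matrix K = Fin K → Fin K → Carrier

  transpose : {K : ℕ} → Matrix K → Matrix K
  transpose A i j = A j i

  mul : {K : ℕ} → Matrix K → Matrix K → Matrix K
  mul {K} A B i j = sumFin K (λ k → A i k * B k j)

  -- Möbius function on prime powers: μ(p^m) for a prime p
  μpp : ℕ → Carrier
  μpp zero          = 1#
  μpp (suc zero)    = - 1#
  μpp (suc (suc m)) = 0#

  -- Parameters: q plays the role of p^{-3/4}, β the role of
  -- (1 - p^{-3/2}) / (1 + p^{-3/2}).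
  -- φ*(p^k) = (k β + 1) / p^{3k/4} = (k β + 1) q^k
  φ* : (q β : Carrier) → ℕ → Carrier
  φ* q β k = (fromℕ k * β + 1#) * pow q k

  𝓜 : (q β : Carrier) (K : ℕ) → Matrix K
  𝓜 q β K i j = φ* q β ∣ toℕ i - toℕ j ∣

  -- 𝓤_K(i,j) = μ(p^{|i-j|}) / p^{3|i-j|/4} if i ≥ j or (i,j) = (K-1,K)
  -- (1-based), i.e. toℕ i ≥ toℕ j or (toℕ i , toℕ j) = (K-2 , K-1); else 0.
  𝓤 : (q : Carrier) (K : ℕ) → Matrix K
  𝓤 q K i j =
    if ⌊ toℕ j ℕ.≤? toℕ i ⌋
       ∨ (⌊ toℕ i ℕ.≟ K ∸ 2 ⌋ ∧ ⌊ toℕ j ℕ.≟ K ∸ 1 ⌋)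
    then μpp ∣ toℕ i - toℕ j ∣ * pow q ∣ toℕ i - toℕ j ∣
    else 0#

  𝓐 : (q β : Carrier) (K : ℕ) → Matrix K
  𝓐 q β K = mul (mul (transpose (𝓤 q K)) (𝓜 q β K)) (𝓤 q K)

  -- The claimed closed form:
  -- β (1 - p^{-3/2}) · (p^{-3|i-j|/4} if 1 ≤ i,j ≤ K-1 or i = j = K; else 0)
  -- (1-based), i.e. toℕ i, toℕ j < K-1, or toℕ i = toℕ j = K-1.
  𝓐-closed : (q β : Carrier) (K : ℕ) → Matrix K
  𝓐-closed q β K i j =
    β * (1# - q * q) *
      (if (⌊ suc (toℕ i) ℕ.≤? K ∸ 1 ⌋ ∧ ⌊ suc (toℕ j) ℕ.≤? K ∸ 1 ⌋)
          ∨ (⌊ toℕ i ℕ.≟ K ∸ 1 ⌋ ∧ ⌊ toℕ j ℕ.≟ K ∸ 1 ⌋)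
       then pow q ∣ toℕ i - toℕ j ∣
       else 0#)

module Submission where

-- Column y of 𝓤 is e_y − q e_y′, where y′ = y + 1 except for the last
-- column, whose partner is y′ = K − 2.  Hence every entry of 𝓤ᵀ 𝓜 𝓤 is
-- the second difference  𝓜(a,b) − q 𝓜(a′,b) − q 𝓜(a,b′) + q² 𝓜(a′,b′).
-- Since 𝓜(a,b) = φ*(|a − b|) with φ*(d) = (dβ + 1) qᵈ, this is governed by
-- the recurrence  φ*(d+2) − 2q φ*(d+1) + q² φ*(d) = 0  of the double root q
-- (zero in the mixed blocks), and its inhomogeneous variant
-- (1 + q²) φ*(d) − q (φ*(d−1) + φ*(d+1)) = β (1 − q²) qᵈ  (diagonal blocks).
-- At d = 0 the reflection |−1| = 1 enters, and there both identities amount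
-- to β (1 + q²) = 1 − q².

open import Defs
open import Algebra.Bundles using (CommutativeRing)
open import Data.Nat using (ℕ; _≤_)
open import Data.Nat.Primality using (Prime)
open import Data.Fin using (Fin)

open import Data.Bool using (Bool; true; false; not; if_then_else_; _∧_; _∨_)
open import Data.Bool.Properties using (∧-zeroʳ)
open import Data.Empty using (⊥-elim)
open import Data.Fin using (toℕ)
open import Data.Fin.Properties using (toℕ<n)
open import Data.Nat using (zero; suc; _<_; z≤n; s≤s; ∣_-_∣; _≤?_; _≟_)
open import Data.Nat.Properties
  using (≤-refl; ≤-antisym; m≤n⇒m≤1+n; m≤n⇒m<n∨m≡n; 1+n≰n; 1+n≢n; suc-injective; ∣n-n∣≡0; ∣-∣-identityʳ; ∣-∣-comm)
open import Data.Product using (Σ; _,_)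
open import Data.Sum using (inj₁; inj₂)
open import Function using (_∘_)
open import Relation.Binary.PropositionalEquality as ≡ using (_≡_; _≢_; cong)
open import Relation.Nullary using (Dec; yes; no; ¬_)
open import Relation.Nullary.Decidable using (⌊_⌋; isYes≗does; dec-true; dec-false)

∣1+n-n∣≡1 : ∀ n → ∣ suc n - n ∣ ≡ 1
∣1+n-n∣≡1 zero    = ≡.refl
∣1+n-n∣≡1 (suc n) = ∣1+n-n∣≡1 n

∣n-1+n∣≡1 : ∀ n → ∣ n - suc n ∣ ≡ 1
∣n-1+n∣≡1 n = ≡.trans (∣-∣-comm n (suc n)) (∣1+n-n∣≡1 n)

2≤∣m-n∣ : ∀ {m n} → n ≤ m → m ≢ n → m ≢ suc n → 2 ≤ ∣ m - n ∣
2≤∣m-n∣ {zero}        z≤n       m≢n _     = ⊥-elim (m≢n ≡.refl)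
2≤∣m-n∣ {suc zero}    z≤n       _   m≢1+n = ⊥-elim (m≢1+n ≡.refl)
2≤∣m-n∣ {suc (suc _)} z≤n       _   _     = s≤s (s≤s z≤n)
2≤∣m-n∣               (s≤s n≤m) m≢n m≢1+n = 2≤∣m-n∣ n≤m (m≢n ∘ cong suc) (m≢1+n ∘ cong suc)

-- Partner m y y′: in 𝓤 of size K = m + 2, column y is e_y − q e_y′.
data Partner (m : ℕ) : ℕ → ℕ → Set where
  below : ∀ {y} → y ≤ m → Partner m y (suc y)
  last  : Partner m (suc m) m

partner : ∀ {m y} → y < suc (suc m) → Σ ℕ (Partner m y)
partner (s≤s y≤1+m) with m≤n⇒m<n∨m≡n y≤1+m
... | inj₁ (s≤s y≤m) = _ , below y≤m
... | inj₂ ≡.refl    = _ , last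

partnerˡ-< : ∀ {m y y′} → Partner m y y′ → y < suc (suc m)
partnerˡ-< (below y≤m) = s≤s (m≤n⇒m≤1+n y≤m)
partnerˡ-< last        = s≤s ≤-refl

partnerʳ-< : ∀ {m y y′} → Partner m y y′ → y′ < suc (suc m)
partnerʳ-< (below y≤m) = s≤s (s≤s y≤m)
partnerʳ-< last        = s≤s (m≤n⇒m≤1+n ≤-refl)

partner-≢ : ∀ {m y y′} → Partner m y y′ → y′ ≢ y
partner-≢ (below _) = 1+n≢n
partner-≢ last      = 1+n≢n ∘ ≡.sym

firstBlock : ∀ {m y y′} → Partner m y y′ → Bool
firstBlock (below _) = true
firstBlock last      = false

sameBlock : ∀ {m a a′ b b′} → Partner m a a′ → Partner m b b′ → Bool
sameBlock pa pb = (firstBlock pa ∧ firstBlock pb) ∨ (not (firstBlock pa) ∧ not (firstBlock pb))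

⌊⌋-yes : ∀ {a} {A : Set a} (a? : Dec A) → A → ⌊ a? ⌋ ≡ true
⌊⌋-yes a? a = ≡.trans (isYes≗does a?) (dec-true a? a)

⌊⌋-no : ∀ {a} {A : Set a} (a? : Dec A) → ¬ A → ⌊ a? ⌋ ≡ false
⌊⌋-no a? ¬a = ≡.trans (isYes≗does a?) (dec-false a? ¬a)

firstBlock-≤? : ∀ {m y y′} (p : Partner m y y′) → ⌊ suc y ≤? suc m ⌋ ≡ firstBlock p
firstBlock-≤? {m} {y} (below y≤m) = ⌊⌋-yes (suc y ≤? suc m) (s≤s y≤m)
firstBlock-≤? {m}     last        = ⌊⌋-no (suc (suc m) ≤? suc m) 1+n≰n

firstBlock-≟ : ∀ {m y y′} (p : Partner m y y′) → ⌊ y ≟ suc m ⌋ ≡ not (firstBlock p)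
firstBlock-≟ {m} {y} (below y≤m) = ⌊⌋-no (y ≟ suc m) λ { ≡.refl → 1+n≰n y≤m }
firstBlock-≟ {m}     last        = ⌊⌋-yes (suc m ≟ suc m) ≡.refl

module _ {c ℓ} (R : CommutativeRing c ℓ) where
  open CommutativeRing R
  open Matrices R
  open import Algebra.Properties.Ring ring
    using (-1*x≈-x; -‿distribˡ-*; x[y-z]≈xy-xz; [y-z]x≈yx-zx; ⁻¹-anti-homo‿-; -‿+-comm)
  open import Algebra.Solver.Ring.NaturalCoefficients.Default commutativeSemiring
    using (solve; _:=_; _:+_; _:*_; con)
  open import Relation.Binary.Reasoning.Setoid setoid

  sumFin-cong : ∀ K {f g : Fin K → Carrier} → (∀ k → f k ≈ g k) → sumFin K f ≈ sumFin K g
  sumFin-cong zero    f≈g = refl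
  sumFin-cong (suc K) f≈g = +-cong (f≈g _) (sumFin-cong K (f≈g ∘ Data.Fin.suc))

  sumFin-≈0 : ∀ K (g : ℕ → Carrier) → (∀ x → x < K → g x ≈ 0#) → sumFin K (g ∘ toℕ) ≈ 0#
  sumFin-≈0 zero    g g≈0 = refl
  sumFin-≈0 (suc K) g g≈0 =
    trans (+-cong (g≈0 0 (s≤s z≤n)) (sumFin-≈0 K (g ∘ suc) (λ x x<K → g≈0 (suc x) (s≤s x<K))))
          (+-identityˡ 0#)

  sumFin-single : ∀ K (g : ℕ → Carrier) {a} → a < K → (∀ x → x < K → x ≢ a → g x ≈ 0#) →
                  sumFin K (g ∘ toℕ) ≈ g a
  sumFin-single (suc K) g {zero} _ g≈0 =
    trans (+-congˡ (sumFin-≈0 K (g ∘ suc) (λ x x<K → g≈0 (suc x) (s≤s x<K) λ ()))) (+-identityʳ (g 0))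
  sumFin-single (suc K) g {suc a} (s≤s a<K) g≈0 =
    trans (+-cong (g≈0 0 (s≤s z≤n) λ ())
                  (sumFin-single K (g ∘ suc) a<K (λ x x<K x≢a → g≈0 (suc x) (s≤s x<K) (x≢a ∘ suc-injective))))
          (+-identityˡ (g (suc a)))

  sumFin-pair : ∀ K (g : ℕ → Carrier) {a b} → a < K → b < K → a ≢ b →
                (∀ x → x < K → x ≢ a → x ≢ b → g x ≈ 0#) → sumFin K (g ∘ toℕ) ≈ g a + g b
  sumFin-pair (suc K) g {zero}  {zero}  _ _ a≢b _ = ⊥-elim (a≢b ≡.refl)
  sumFin-pair (suc K) g {zero}  {suc b} _ (s≤s b<K) _ g≈0 =
    +-congˡ (sumFin-single K (g ∘ suc) b<K (λ x x<K x≢b → g≈0 (suc x) (s≤s x<K) (λ ()) (x≢b ∘ suc-injective)))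
  sumFin-pair (suc K) g {suc a} {zero}  (s≤s a<K) _ _ g≈0 =
    trans (+-congˡ (sumFin-single K (g ∘ suc) a<K
                      (λ x x<K x≢a → g≈0 (suc x) (s≤s x<K) (x≢a ∘ suc-injective) λ ())))
          (+-comm (g 0) (g (suc a)))
  sumFin-pair (suc K) g {suc a} {suc b} (s≤s a<K) (s≤s b<K) a≢b g≈0 =
    trans (+-cong (g≈0 0 (s≤s z≤n) (λ ()) (λ ()))
                  (sumFin-pair K (g ∘ suc) a<K b<K (a≢b ∘ cong suc)
                     (λ x x<K x≢a x≢b → g≈0 (suc x) (s≤s x<K) (x≢a ∘ suc-injective) (x≢b ∘ suc-injective))))
          (+-identityˡ _)

  x+u≈y+v⇒x-y≈v-u : ∀ x y u v → x + u ≈ y + v → x - y ≈ v - u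
  x+u≈y+v⇒x-y≈v-u x y u v x+u≈y+v = begin
    x - y                 ≈⟨ sym (+-identityʳ (x - y)) ⟩
    (x - y) + 0#          ≈⟨ +-congˡ (sym (-‿inverseʳ u)) ⟩
    (x - y) + (u - u)     ≈⟨ solve 4 (λ x -y u -u → (x :+ -y) :+ (u :+ -u) := (x :+ u) :+ (-u :+ -y)) refl x (- y) u (- u) ⟩
    (x + u) + (- u - y)   ≈⟨ +-congʳ x+u≈y+v ⟩
    (y + v) + (- u - y)   ≈⟨ solve 4 (λ y v -u -y → (y :+ v) :+ (-u :+ -y) := (v :+ -u) :+ (y :+ -y)) refl y v (- u) (- y) ⟩
    (v - u) + (y - y)     ≈⟨ +-congˡ (-‿inverseʳ y) ⟩
    (v - u) + 0#          ≈⟨ +-identityʳ (v - u) ⟩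
    v - u                 ∎

  [a-qb]-q[c-qd]≈[a+qqd]-[qb+qc] : ∀ q a b c d →
    (a - q * b) - q * (c - q * d) ≈ (a + q * (q * d)) - (q * b + q * c)
  [a-qb]-q[c-qd]≈[a+qqd]-[qb+qc] q a b c d = begin
    (a - q * b) - q * (c - q * d)          ≈⟨ +-congˡ (-‿cong (x[y-z]≈xy-xz q c (q * d))) ⟩
    (a - q * b) - (q * c - q * (q * d))    ≈⟨ +-congˡ (⁻¹-anti-homo‿- (q * c) (q * (q * d))) ⟩
    (a - q * b) + (q * (q * d) - q * c)    ≈⟨ solve 4 (λ a -qb qqd -qc → (a :+ -qb) :+ (qqd :+ -qc) := (a :+ qqd) :+ (-qb :+ -qc))
                                                      refl a (- (q * b)) (q * (q * d)) (- (q * c)) ⟩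
    (a + q * (q * d)) + (- (q * b) - q * c) ≈⟨ +-congˡ (-‿+-comm (q * b) (q * c)) ⟩
    (a + q * (q * d)) - (q * b + q * c)    ∎

  μpp-vanishes : ∀ {d} → 2 ≤ d → (x : Carrier) → μpp d * x ≈ 0#
  μpp-vanishes (s≤s (s≤s _)) = zeroˡ

  module _ (q : Carrier) (m : ℕ) where

    -- 𝓤 q (suc (suc m)) i j reduces to U (toℕ i) (toℕ j).
    U : ℕ → ℕ → Carrier
    U x y = if ⌊ y ≤? x ⌋ ∨ (⌊ x ≟ m ⌋ ∧ ⌊ y ≟ suc m ⌋) then μpp ∣ x - y ∣ * pow q ∣ x - y ∣ else 0#

    U-diag : ∀ y → U y y ≈ 1#
    U-diag y rewrite ⌊⌋-yes (y ≤? y) ≤-refl | ∣n-n∣≡0 y = *-identityʳ 1#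

    μpp1*q¹≈-q : μpp 1 * pow q 1 ≈ - q
    μpp1*q¹≈-q = trans (-1*x≈-x (q * 1#)) (-‿cong (*-identityʳ q))

    U-partner : ∀ {y y′} → Partner m y y′ → U y′ y ≈ - q
    U-partner {y} (below _)
      rewrite ⌊⌋-yes (y ≤? suc y) (m≤n⇒m≤1+n ≤-refl) | ∣1+n-n∣≡1 y = μpp1*q¹≈-q
    U-partner last
      rewrite ⌊⌋-no (suc m ≤? m) 1+n≰n | ⌊⌋-yes (m ≟ m) ≡.refl | ⌊⌋-yes (suc m ≟ suc m) ≡.refl | ∣n-1+n∣≡1 m
      = μpp1*q¹≈-q

    U-off : ∀ {x y y′} → Partner m y y′ → x < suc (suc m) → x ≢ y → x ≢ y′ → U x y ≈ 0#
    U-off {x} {y} (below y≤m) _ x≢y x≢1+y with y ≤? x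
    ... | yes y≤x = μpp-vanishes (2≤∣m-n∣ y≤x x≢y x≢1+y) _
    ... | no  _   rewrite firstBlock-≟ (below y≤m) | ∧-zeroʳ ⌊ x ≟ m ⌋ = refl
    U-off {x} last (s≤s x≤1+m) x≢1+m x≢m with suc m ≤? x
    ... | yes 1+m≤x = ⊥-elim (x≢1+m (≤-antisym x≤1+m 1+m≤x))
    ... | no  _     rewrite ⌊⌋-no (x ≟ m) x≢m = refl

    U-columnˡ : ∀ {y y′} → Partner m y y′ → (g : ℕ → Carrier) →
                sumFin (suc (suc m)) (λ k → U (toℕ k) y * g (toℕ k)) ≈ g y - q * g y′
    U-columnˡ {y} {y′} p g = begin
      sumFin (suc (suc m)) (λ k → U (toℕ k) y * g (toℕ k))
        ≈⟨ sumFin-pair (suc (suc m)) (λ x → U x y * g x) (partnerˡ-< p) (partnerʳ-< p) (partner-≢ p ∘ ≡.sym)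
             (λ x x<K x≢y x≢y′ → trans (*-congʳ (U-off p x<K x≢y x≢y′)) (zeroˡ (g x))) ⟩
      U y y * g y + U y′ y * g y′
        ≈⟨ +-cong (trans (*-congʳ (U-diag y)) (*-identityˡ (g y)))
                  (trans (*-congʳ (U-partner p)) (sym (-‿distribˡ-* q (g y′)))) ⟩
      g y - q * g y′ ∎

    U-columnʳ : ∀ {y y′} → Partner m y y′ → (g : ℕ → Carrier) →
                sumFin (suc (suc m)) (λ k → g (toℕ k) * U (toℕ k) y) ≈ g y - q * g y′
    U-columnʳ {y} p g = trans (sumFin-cong (suc (suc m)) (λ k → *-comm (g (toℕ k)) (U (toℕ k) y))) (U-columnˡ p g)

    UᵀGU-entry : ∀ {a a′ b b′} → Partner m a a′ → Partner m b b′ → (G : ℕ → ℕ → Carrier) →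
      sumFin (suc (suc m)) (λ l → sumFin (suc (suc m)) (λ k → U (toℕ k) a * G (toℕ k) (toℕ l)) * U (toℕ l) b)
        ≈ (G a b - q * G a′ b) - q * (G a b′ - q * G a′ b′)
    UᵀGU-entry {a} {a′} {b} pa pb G =
      trans (sumFin-cong (suc (suc m)) {g = λ l → (G a (toℕ l) - q * G a′ (toℕ l)) * U (toℕ l) b}
                         (λ l → *-congʳ (U-columnˡ pa (λ k → G k (toℕ l)))))
            (U-columnʳ pb (λ l → G a l - q * G a′ l))

  module _ (q β : Carrier) where

    φ : ℕ → Carrier
    φ = φ* q β

    κ : Carrier
    κ = β * (1# - q * q)

    Δ : (a a′ b b′ : ℕ) → Carrier
    Δ a a′ b b′ = (φ ∣ a - b ∣ - q * φ ∣ a′ - b ∣) - q * (φ ∣ a - b′ ∣ - q * φ ∣ a′ - b′ ∣)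

    -- The hypothesis is free of subtraction, so the commutative-semiring
    -- solver can discharge it for φ.
    balance⇒second-difference : ∀ A B C D P →
      A + q * (q * D) + β * (q * q) * P ≈ q * B + q * C + β * P →
      (A - q * B) - q * (C - q * D) ≈ κ * P
    balance⇒second-difference A B C D P balance = begin
      (A - q * B) - q * (C - q * D)        ≈⟨ [a-qb]-q[c-qd]≈[a+qqd]-[qb+qc] q A B C D ⟩
      (A + q * (q * D)) - (q * B + q * C)  ≈⟨ x+u≈y+v⇒x-y≈v-u _ _ _ _ balance ⟩
      β * P - β * (q * q) * P              ≈⟨ +-congʳ (*-congʳ (*-identityʳ β)) ⟨
      β * 1# * P - β * (q * q) * P         ≈⟨ [y-z]x≈yx-zx P (β * 1#) (β * (q * q)) ⟨
      (β * 1# - β * (q * q)) * P           ≈⟨ *-congʳ (x[y-z]≈xy-xz β 1# (q * q)) ⟨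
      κ * P                                ∎

    φ-inhomogeneous : ∀ d → φ (suc d) + q * (q * φ (suc d)) + β * (q * q) * pow q (suc d)
                         ≈ q * φ d + q * φ (suc (suc d)) + β * pow q (suc d)
    φ-inhomogeneous d = solve 4 (λ F b x P →
        ((con 1 :+ F) :* b :+ con 1) :* (x :* P) :+ x :* (x :* (((con 1 :+ F) :* b :+ con 1) :* (x :* P)))
          :+ b :* (x :* x) :* (x :* P)
        := x :* ((F :* b :+ con 1) :* P) :+ x :* (((con 1 :+ (con 1 :+ F)) :* b :+ con 1) :* (x :* (x :* P)))
          :+ b :* (x :* P))
      refl (fromℕ d) β q (pow q d)

    φ-recurrence : ∀ d → φ (suc (suc d)) + q * (q * φ d) + β * (q * q) * 0#
                     ≈ q * φ (suc d) + q * φ (suc d) + β * 0#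
    φ-recurrence d = solve 4 (λ F b x P →
        ((con 1 :+ (con 1 :+ F)) :* b :+ con 1) :* (x :* (x :* P)) :+ x :* (x :* ((F :* b :+ con 1) :* P))
          :+ b :* (x :* x) :* con 0
        := x :* (((con 1 :+ F) :* b :+ con 1) :* (x :* P)) :+ x :* (((con 1 :+ F) :* b :+ con 1) :* (x :* P))
          :+ b :* con 0)
      refl (fromℕ d) β q (pow q d)

    module _ (β-rel : β * (1# + q * q) ≈ 1# - q * q) where

      β-rel′ : β * (1# + q * q) + q * q ≈ 1#
      β-rel′ = begin
        β * (1# + q * q) + q * q    ≈⟨ +-congʳ β-rel ⟩
        1# - q * q + q * q          ≈⟨ +-assoc 1# (- (q * q)) (q * q) ⟩
        1# + (- (q * q) + q * q)    ≈⟨ +-congˡ (-‿inverseˡ (q * q)) ⟩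
        1# + 0#                     ≈⟨ +-identityʳ 1# ⟩
        1#                          ∎

      φ-inhomogeneous-reflected : φ 0 + q * (q * φ 0) + β * (q * q) * pow q 0 ≈ q * φ 1 + q * φ 1 + β * pow q 0
      φ-inhomogeneous-reflected = begin
        φ 0 + q * (q * φ 0) + β * (q * q) * pow q 0
          ≈⟨ solve 2 (λ b x → ((con 0 :* b :+ con 1) :* con 1) :+ x :* (x :* ((con 0 :* b :+ con 1) :* con 1))
                                :+ b :* (x :* x) :* con 1
                              := con 1 :+ (x :* x :+ b :* (x :* x))) refl β q ⟩
        1# + (q * q + β * (q * q))
          ≈⟨ +-congʳ β-rel′ ⟨
        (β * (1# + q * q) + q * q) + (q * q + β * (q * q))
          ≈⟨ solve 2 (λ b x → (b :* (con 1 :+ x :* x) :+ x :* x) :+ (x :* x :+ b :* (x :* x))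
                              := x :* (((con 1 :+ con 0) :* b :+ con 1) :* (x :* con 1))
                                 :+ x :* (((con 1 :+ con 0) :* b :+ con 1) :* (x :* con 1)) :+ b :* con 1) refl β q ⟩
        q * φ 1 + q * φ 1 + β * pow q 0 ∎

      φ-recurrence-reflected : φ 1 + q * (q * φ 1) + β * (q * q) * 0# ≈ q * φ 0 + q * φ 0 + β * 0#
      φ-recurrence-reflected = begin
        φ 1 + q * (q * φ 1) + β * (q * q) * 0#
          ≈⟨ solve 2 (λ b x → ((con 1 :+ con 0) :* b :+ con 1) :* (x :* con 1)
                                :+ x :* (x :* (((con 1 :+ con 0) :* b :+ con 1) :* (x :* con 1))) :+ b :* (x :* x) :* con 0
                              := x :* (b :* (con 1 :+ x :* x) :+ x :* x) :+ x) refl β q ⟩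
        q * (β * (1# + q * q) + q * q) + q
          ≈⟨ +-congʳ (*-congˡ β-rel′) ⟩
        q * 1# + q
          ≈⟨ solve 2 (λ b x → x :* con 1 :+ x
                              := x :* ((con 0 :* b :+ con 1) :* con 1) :+ x :* ((con 0 :* b :+ con 1) :* con 1)
                                 :+ b :* con 0) refl β q ⟩
        q * φ 0 + q * φ 0 + β * 0# ∎

      Δ-interior-interior : ∀ a b → Δ a (suc a) b (suc b) ≈ κ * pow q ∣ a - b ∣
      Δ-interior-interior zero    zero    = balance⇒second-difference _ _ _ _ _ φ-inhomogeneous-reflected
      Δ-interior-interior zero    (suc b) = balance⇒second-difference _ _ _ _ _ (φ-inhomogeneous b)
      Δ-interior-interior (suc a) zero    rewrite ∣-∣-identityʳ a =
        balance⇒second-difference _ _ _ _ _ (trans (φ-inhomogeneous a) (+-congʳ (+-comm _ _)))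
      Δ-interior-interior (suc a) (suc b) = Δ-interior-interior a b

      Δ-last-interior : ∀ n b → b ≤ n → Δ (suc n) n b (suc b) ≈ κ * 0#
      Δ-last-interior zero    zero    _         = balance⇒second-difference _ _ _ _ _ φ-recurrence-reflected
      Δ-last-interior (suc n) zero    _         rewrite ∣-∣-identityʳ n = balance⇒second-difference _ _ _ _ _ (φ-recurrence n)
      Δ-last-interior (suc n) (suc b) (s≤s b≤n) = Δ-last-interior n b b≤n

      Δ-interior-last : ∀ a n → a ≤ n → Δ a (suc a) (suc n) n ≈ κ * 0#
      Δ-interior-last zero    zero    _         = balance⇒second-difference _ _ _ _ _ φ-recurrence-reflected
      Δ-interior-last zero    (suc n) _         = balance⇒second-difference _ _ _ _ _ (φ-recurrence n)
      Δ-interior-last (suc a) (suc n) (s≤s a≤n) = Δ-interior-last a n a≤n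

      Δ-last-last : ∀ n → Δ (suc n) n (suc n) n ≈ κ * pow q ∣ suc n - suc n ∣
      Δ-last-last n rewrite ∣n-n∣≡0 n | ∣n-1+n∣≡1 n | ∣1+n-n∣≡1 n = balance⇒second-difference _ _ _ _ _ φ-inhomogeneous-reflected

      Δ-block : ∀ {m a a′ b b′} (pa : Partner m a a′) (pb : Partner m b b′) →
                Δ a a′ b b′ ≈ κ * (if sameBlock pa pb then pow q ∣ a - b ∣ else 0#)
      Δ-block {a = a} {b = b} (below _)   (below _)   = Δ-interior-interior a b
      Δ-block {m} {a}         (below a≤m) last        = Δ-interior-last a m a≤m
      Δ-block {m} {b = b}     last        (below b≤m) = Δ-last-interior m b b≤m
      Δ-block {m}             last        last        = Δ-last-last m

    𝓐-closed-block : ∀ {m a′ b′} {i j : Fin (suc (suc m))}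
                     (pa : Partner m (toℕ i) a′) (pb : Partner m (toℕ j) b′) →
                     𝓐-closed q β (suc (suc m)) i j ≡ κ * (if sameBlock pa pb then pow q ∣ toℕ i - toℕ j ∣ else 0#)
    𝓐-closed-block pa pb
      rewrite firstBlock-≤? pa | firstBlock-≤? pb | firstBlock-≟ pa | firstBlock-≟ pb = ≡.refl

-- Primality of p and t⁴ p = 1 only identify q = t³ with p^{-3/4}; the
-- identity holds for every q satisfying the relation with β.
proposition6p1 : ∀ {c ℓ} (R : CommutativeRing c ℓ) → let open CommutativeRing R in let open Matrices R in
    (p : ℕ) → Prime p → (K : ℕ) → 2 ≤ K →
    (t β : Carrier) → pow t 4 * fromℕ p ≈ 1# →
    β * (1# + pow t 3 * pow t 3) ≈ 1# - pow t 3 * pow t 3 →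
    (i j : Fin K) → 𝓐 (pow t 3) β K i j ≈ 𝓐-closed (pow t 3) β K i j
proposition6p1 R _ _ (suc (suc m)) (s≤s (s≤s z≤n)) t β _ β-rel i j
  with _ , pa ← partner (toℕ<n i) | _ , pb ← partner (toℕ<n j) =
  trans (UᵀGU-entry R q m pa pb (λ x y → φ* q β ∣ x - y ∣))
        (trans (Δ-block R q β β-rel pa pb) (reflexive (≡.sym (𝓐-closed-block R q β pa pb))))
  where
  open CommutativeRing R
  open Matrices R
  q : Carrier
  q = pow t 3
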